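{- Let $G$ be a $\Gamma$-vertex-transitive graph, where $\Gamma$ is a subgroup of $\mathrm{Aut}(G)$. Let $\Lambda$ be a normal subgroup of $\Gamma$ acting semiregularly on $V(G)$. If at least one $\Lambda$-orbit on $V(G)$ is an independent set of $G$, then $\Lambda$ acts semiregularly on $E(G)$.
   Context: Graphs are finite, undirected, with parallel edges allowed; vertex-transitive graphs have no loops. $\mathrm{Aut}(G)$ consists of incidence-preserving bijections of $V(G)\cup E(G)$ mapping vertices to vertices and edges to edges (so an element may fix an edge by swapping its end-vertices). $G$ is $\Gamma$-vertex-transitive if $\Gamma\le\mathrm{Aut}(G)$ is transitive on $V(G)$. A group acts semiregularly on a set if no nonidentity element fixes a point. -}

module Defs where

open import Data.Nat using (ℕ)
open import Data.Fin using (Fin)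
open import Data.Fin.Permutation as P using (Permutation′; _⟨$⟩ʳ_; _⟨$⟩ˡ_; _∘ₚ_; inverseʳ; inverseˡ)
open import Data.Product using (Σ; _×_; _,_; proj₁; proj₂; ∃)
open import Data.Sum using (_⊎_; inj₁; inj₂)
open import Relation.Nullary using (¬_)
open import Relation.Binary.PropositionalEquality using (_≡_; _≢_; refl; sym; trans; cong; subst)

-- A finite multigraph: vertices Fin nV, edges Fin nE, each edge has two
-- end-vertices (unordered; the order in `ends` carries no meaning).
record Graph : Set where
  field
    nV   : ℕ
    nE   : ℕ
    ends : Fin nE → Fin nV × Fin nV
open Graph public

Inc : (G : Graph) → Fin (nV G) → Fin (nE G) → Set
Inc G v e = (v ≡ proj₁ (ends G e)) ⊎ (v ≡ proj₂ (ends G e))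

Loopless : Graph → Set
Loopless G = ∀ e → proj₁ (ends G e) ≢ proj₂ (ends G e)

record Aut (G : Graph) : Set where
  field
    vperm : Permutation′ (nV G)
    eperm : Permutation′ (nE G)
    pres  : ∀ v e → Inc G v e → Inc G (vperm ⟨$⟩ʳ v) (eperm ⟨$⟩ʳ e)
    refl′ : ∀ v e → Inc G (vperm ⟨$⟩ʳ v) (eperm ⟨$⟩ʳ e) → Inc G v e
open Aut public

module _ {G : Graph} where

  _·v_ : Aut G → Fin (nV G) → Fin (nV G)
  g ·v v = vperm g ⟨$⟩ʳ v

  _·e_ : Aut G → Fin (nE G) → Fin (nE G)
  g ·e e = eperm g ⟨$⟩ʳ e

  _≈A_ : Aut G → Aut G → Set
  g ≈A h = (∀ v → g ·v v ≡ h ·v v) × (∀ e → g ·e e ≡ h ·e e)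

  idA : Aut G
  idA = record { vperm = P.id ; eperm = P.id ; pres = λ v e i → i ; refl′ = λ v e i → i }

  -- g ∘A h : first h, then g
  _∘A_ : Aut G → Aut G → Aut G
  g ∘A h = record
    { vperm = vperm h ∘ₚ vperm g
    ; eperm = eperm h ∘ₚ eperm g
    ; pres  = λ v e i → pres g _ _ (pres h v e i)
    ; refl′ = λ v e i → refl′ h v e (refl′ g _ _ i)
    }

  _⁻¹A : Aut G → Aut G
  g ⁻¹A = record
    { vperm = P.flip (vperm g)
    ; eperm = P.flip (eperm g)
    ; pres  = λ v e i → refl′ g _ _ (subst₂ (Inc G) (sym (inverseʳ (vperm g))) (sym (inverseʳ (eperm g))) i)
    ; refl′ = λ v e i → subst₂ (Inc G) (inverseʳ (vperm g)) (inverseʳ (eperm g)) (pres g _ _ i)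
    }
    where
    subst₂ : ∀ (R : Fin (nV G) → Fin (nE G) → Set) {a b c d} → a ≡ b → c ≡ d → R a c → R b d
    subst₂ R refl refl r = r

  record IsSubgroup (Γ : Aut G → Set) : Set where
    field
      resp  : ∀ {g h} → g ≈A h → Γ g → Γ h
      ∈id   : Γ idA
      ∈∘    : ∀ {g h} → Γ g → Γ h → Γ (g ∘A h)
      ∈⁻¹   : ∀ {g} → Γ g → Γ (g ⁻¹A)

  record IsNormalSubgroupOf (Λ Γ : Aut G → Set) : Set where
    field
      subgroup : IsSubgroup Λ
      ⊆Γ       : ∀ {h} → Λ h → Γ h
      conj     : ∀ {g h} → Γ g → Λ h → Λ ((g ∘A h) ∘A (g ⁻¹A))

  VertexTransitive : (Aut G → Set) → Set
  VertexTransitive Γ = ∀ u v → Σ (Aut G) λ g → Γ g × (g ·v u ≡ v)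

  SemiregularOnV : (Aut G → Set) → Set
  SemiregularOnV Λ = ∀ h → Λ h → ∀ v → h ·v v ≡ v → h ≈A idA

  SemiregularOnE : (Aut G → Set) → Set
  SemiregularOnE Λ = ∀ h → Λ h → ∀ e → h ·e e ≡ e → h ≈A idA

  InOrbit : (Aut G → Set) → Fin (nV G) → Fin (nV G) → Set
  InOrbit Λ u v = Σ (Aut G) λ h → Λ h × (h ·v u ≡ v)

  Independent : (Fin (nV G) → Set) → Set
  Independent S = ∀ e → ¬ (S (proj₁ (ends G e)) × S (proj₂ (ends G e)))

-- Suppose h ∈ Λ fixes an edge e with ends a, b. If h fixes a, semiregularity on
-- vertices gives h = 1. Otherwise h swaps a and b. Move a into the independent
-- orbit Λu by some g ∈ Γ; then g·a = u and g·b = g h a = (g h g⁻¹)(g·a), so by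
-- normality both ends of the edge g·e lie in Λu, a contradiction.
module Submission where

open import Defs
open import Data.Fin using (Fin)
open import Data.Product using (Σ; _×_; _,_; proj₁; proj₂)
open import Data.Sum using (_⊎_; inj₁; inj₂)
open import Data.Empty using (⊥-elim)
open import Function using (_∘_)
open import Relation.Binary.PropositionalEquality
  using (_≡_; _≢_; refl; sym; cong; subst; module ≡-Reasoning)
open import Data.Fin.Permutation using (_⟨$⟩ˡ_; inverseˡ)

distinct-members-of-pair : ∀ {A : Set} (S : A → Set) {p q x y : A} → x ≢ y →
  (x ≡ p ⊎ x ≡ q) → (y ≡ p ⊎ y ≡ q) → S x → S y → S p × S q
distinct-members-of-pair S x≢y (inj₁ refl) (inj₁ refl) sx sy = ⊥-elim (x≢y refl)
distinct-members-of-pair S x≢y (inj₁ refl) (inj₂ refl) sx sy = sx , sy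
distinct-members-of-pair S x≢y (inj₂ refl) (inj₁ refl) sx sy = sy , sx
distinct-members-of-pair S x≢y (inj₂ refl) (inj₂ refl) sx sy = ⊥-elim (x≢y refl)

module _ {G : Graph} where

  ·v-injective : (g : Aut G) {x y : Fin (nV G)} → g ·v x ≡ g ·v y → x ≡ y
  ·v-injective g {x} {y} gx≡gy = begin
    x                                ≡⟨ sym (inverseˡ (vperm g)) ⟩
    vperm g ⟨$⟩ˡ (g ·v x)            ≡⟨ cong (vperm g ⟨$⟩ˡ_) gx≡gy ⟩
    vperm g ⟨$⟩ˡ (g ·v y)            ≡⟨ inverseˡ (vperm g) ⟩
    y                                ∎
    where open ≡-Reasoning

  ·e-fixed⇒·v-end : (h : Aut G) (e : Fin (nE G)) → h ·e e ≡ e →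
    Inc G (h ·v proj₁ (ends G e)) e
  ·e-fixed⇒·v-end h e he≡e = subst (Inc G _) he≡e (pres h _ e (inj₁ refl))

  Loopless⇒·v-ends-distinct : Loopless G → (g : Aut G) (e : Fin (nE G)) →
    g ·v proj₁ (ends G e) ≢ g ·v proj₂ (ends G e)
  Loopless⇒·v-ends-distinct loopless g e = loopless e ∘ ·v-injective g

  InOrbit-refl : {Λ : Aut G → Set} → IsSubgroup Λ → ∀ u → InOrbit Λ u u
  InOrbit-refl sgΛ u = idA , IsSubgroup.∈id sgΛ , refl

  conj-·v : (g h : Aut G) (x : Fin (nV G)) →
    ((g ∘A h) ∘A (g ⁻¹A)) ·v (g ·v x) ≡ g ·v (h ·v x)
  conj-·v g h x = cong (λ y → g ·v (h ·v y)) (inverseˡ (vperm g))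

  InOrbit-conj : {Γ Λ : Aut G → Set} → IsNormalSubgroupOf Λ Γ →
    ∀ {g h} → Γ g → Λ h → ∀ {u} x → g ·v x ≡ u → InOrbit Λ u (g ·v (h ·v x))
  InOrbit-conj nΛ {g} {h} Γg Λh x refl =
    (g ∘A h) ∘A (g ⁻¹A) , IsNormalSubgroupOf.conj nΛ Γg Λh , conj-·v g h x

lemma4p2 : (G : Graph) → Loopless G → (Γ Λ : Aut G → Set) →
    IsSubgroup Γ → VertexTransitive Γ →
    IsNormalSubgroupOf Λ Γ → SemiregularOnV Λ →
    Σ (Fin (nV G)) (λ u → Independent {G} (InOrbit Λ u)) →
    SemiregularOnE Λ
lemma4p2 G loopless Γ Λ _ vt nΛ semiV (u , indep) h Λh e he≡e
  with ·e-fixed⇒·v-end h e he≡e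
... | inj₁ ha≡a = semiV h Λh _ ha≡a
... | inj₂ ha≡b = ⊥-elim (indep (g ·e e) ends-in-orbit)
  where
  a = proj₁ (ends G e)
  b = proj₂ (ends G e)
  g = proj₁ (vt a u)
  Γg = proj₁ (proj₂ (vt a u))
  ga≡u = proj₂ (proj₂ (vt a u))

  gb-in-orbit : InOrbit Λ u (g ·v b)
  gb-in-orbit = subst (λ y → InOrbit Λ u (g ·v y)) ha≡b (InOrbit-conj nΛ Γg Λh a ga≡u)

  ends-in-orbit : InOrbit Λ u (proj₁ (ends G (g ·e e))) × InOrbit Λ u (proj₂ (ends G (g ·e e)))
  ends-in-orbit = distinct-members-of-pair (InOrbit Λ u)
    (Loopless⇒·v-ends-distinct loopless g e)
    (pres g a e (inj₁ refl)) (pres g b e (inj₂ refl))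
    (subst (InOrbit Λ u) (sym ga≡u) (InOrbit-refl (IsNormalSubgroupOf.subgroup nΛ) u))
    gb-in-orbit
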